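{- Let $T$ be a circle-tree determined by the sequence of circles $(C(i):i<k)$. If $k\ge 2$, then there are at least two $P$-vertices in $T$; more precisely, there are $i<k-1$, $u_i\in C(i)$ and $u_{k-1}\in C(k-1)$ such that for each $j\in\{i,k-1\}$, $u_j$ is the unique vertex of $C(j)$ of degree $3$ in $T$. Moreover, if $k\ge 2$ and $T$ has exactly two $P$-vertices, then $Q_T$ is a line segment and the two $P$-vertices of $T$ belong to the circles corresponding to the endpoints of $Q_T$.
   Context: All graphs are finite simple graphs. A circle is a finite connected graph in which every vertex has degree exactly $2$. A line segment is a finite connected graph of maximum degree $2$ in which some vertex has degree less than $2$ (equivalently, a path graph). For disjoint graphs $G,H$ with $\Delta(G),\Delta(H)\le3$ and vertices $x\in G$, $y\in H$ of degree $2$ in their respective graphs, $G+_{x,y}H$ is the disjoint union of $G$ and $H$ with the single extra edge $\{x,y\}$. A finite graph $T$ is a circle-tree determined by circles $(C(i):i<k)$ if $T(0)=C(0)$, for each $0<i<k$ the circle $C(i)$ is disjoint from $T(i-1)$ and $T(i)=T(i-1)+_{x,y}C(i)$ for some $x\in T(i-1)$ of degree $2$ in $T(i-1)$ and $y\in C(i)$, and $T=T(k-1)$. The quotient $Q_T$ is the graph with vertex set $\{C(i):i<k\}$ in which, for $i\ne j$, $C(i)$ and $C(j)$ are adjacent iff $C(i)\cup C(j)$ induces a connected subgraph of $T$. A vertex $v$ of a graph $G$ is a $P$-vertex of $G$ if $\delta_G(v)=3$ and there is a set $C$ of vertices inducing a circle in $G$ with $v\in C$ and $\delta_G(u)=2$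 for all $u\in C\setminus\{v\}$. -}

module Defs where

open import Data.Nat using (ℕ; zero; suc; _+_; _≤_; _<_)
open import Data.Fin using (Fin; splitAt; inject₁; fromℕ; toℕ)
open import Data.Sum using (_⊎_; inj₁; inj₂)
open import Data.Product using (Σ; ∃; ∃-syntax; _×_; _,_)
open import Data.List using (List; length)
open import Data.List.Membership.Propositional using (_∈_)
open import Data.List.Relation.Unary.Unique.Propositional using (Unique)
open import Relation.Binary.PropositionalEquality using (_≡_; _≢_)
open import Relation.Binary.Construct.Closure.ReflexiveTransitive using (Star)
open import Relation.Nullary using (¬_)
open import Function.Bundles using (_⇔_)

record Graph : Set₁ where
  field
    V : ℕ
    E : Fin V → Fin V → Set
open Graph public

Simple : Graph → Set
Simple G = (∀ a b → E G a b → E G b a) × (∀ a → ¬ E G a a)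

VSet : ℕ → Set₁
VSet n = Fin n → Set

Card : {n : ℕ} → VSet n → ℕ → Set
Card {n} P d = Σ (List (Fin n)) λ l → Unique l × length l ≡ d × (∀ w → P w ⇔ (w ∈ l))

Degree : (G : Graph) → Fin (V G) → ℕ → Set
Degree G v d = Card (E G v) d

InducedEdge : (G : Graph) → VSet (V G) → Fin (V G) → Fin (V G) → Set
InducedEdge G S a b = S a × S b × E G a b

InducesConnected : (G : Graph) → VSet (V G) → Set
InducesConnected G S =
  (∃[ v ] S v) × (∀ u v → S u → S v → Star (InducedEdge G S) u v)

InducesCircle : (G : Graph) → VSet (V G) → Set
InducesCircle G S =
  InducesConnected G S × (∀ u → S u → Card (λ w → S w × E G u w) 2)

Connected : Graph → Set
Connected G = InducesConnected G (λ _ → Fin 1)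

IsCircle : Graph → Set
IsCircle G = Simple G × Connected G × (∀ v → Degree G v 2)

IsLineSegment : Graph → Set
IsLineSegment G =
  Simple G × Connected G
  × (∀ v → ∃[ d ] (d ≤ 2 × Degree G v d))
  × (∃[ v ] ∃[ d ] (d < 2 × Degree G v d))

-- G +_{x,y} H : disjoint union (vertices of G first, then H) plus edge {x,y}
glue : (G : Graph) → Fin (V G) → (H : Graph) → Fin (V H) → Graph
glue G x H y = record { V = V G + V H ; E = λ a b → GE (splitAt (V G) a) (splitAt (V G) b) }
  where
  GE : Fin (V G) ⊎ Fin (V H) → Fin (V G) ⊎ Fin (V H) → Set
  GE (inj₁ i) (inj₁ j) = E G i j
  GE (inj₂ i) (inj₂ j) = E H i j
  GE (inj₁ i) (inj₂ j) = i ≡ x × j ≡ y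
  GE (inj₂ i) (inj₁ j) = j ≡ x × i ≡ y

-- Circle-trees determined by circles (C(i) : i < k), k ≥ 1.
-- CircleTree k : a construction T(0), ..., T(k-1);
-- tree t : the graph T = T(k-1);
-- part t v = i  iff  vertex v of T belongs to the circle C(i).

data CircleTree : ℕ → Set₁
tree : {k : ℕ} → CircleTree k → Graph

data CircleTree where
  base : (C : Graph) → IsCircle C → CircleTree 1
  step : {k : ℕ} (t : CircleTree k) (C : Graph) → IsCircle C →
         (x : Fin (V (tree t))) → Degree (tree t) x 2 →
         (y : Fin (V C)) → CircleTree (suc k)

tree (base C _) = C
tree (step t C _ x _ y) = glue (tree t) x C y

part : {k : ℕ} (t : CircleTree k) → Fin (V (tree t)) → Fin k
part (base C _) v = Fin.zero
  where import Data.Fin as Fin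
part {suc k} (step t C _ x _ y) v with splitAt (V (tree t)) v
... | inj₁ a = inject₁ (part t a)
... | inj₂ _ = fromℕ k

-- the quotient Q_T : C(i) ~ C(j) iff i ≠ j and C(i) ∪ C(j) induces
-- a connected subgraph of T
quotient : {k : ℕ} → CircleTree k → Graph
quotient {k} t = record
  { V = k
  ; E = λ i j → i ≢ j × InducesConnected (tree t) (λ v → part t v ≡ i ⊎ part t v ≡ j) }

IsPVertex : (G : Graph) → Fin (V G) → Set₁
IsPVertex G v =
  Degree G v 3 ×
  Σ (VSet (V G)) λ S → InducesCircle G S × S v × (∀ u → S u → u ≢ v → Degree G u 2)

{-# OPTIONS --safe #-}
-- Every vertex of T has degree 2 or 3, and the degree-3 vertices of C(c) are exactly the points where
-- C(c) is glued to another circle; so their number is the degree of C(c) in Q_T, and Q_T is a tree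
-- whose edges are the gluings.  A leaf of Q_T therefore contains a unique degree-3 vertex, which is a
-- P-vertex.  The last circle is a leaf, and since a circle of degree d in Q_T sees d distinct leaves
-- besides itself, there is another one.  If T has only two P-vertices, Q_T has at most two leaves, so
-- every circle has degree at most 2 and the connected graph Q_T is a line segment with those leaves as ends.
module Submission where

open import Defs
open import Data.Nat using (ℕ; zero; suc; _+_; _≤_; _<_; z≤n; s≤s; _≟_)
open import Data.Fin as Fin using (Fin; _↑ˡ_; _↑ʳ_; splitAt; toℕ; fromℕ<; fromℕ) renaming (zero to 0F)
open import Data.Fin.Properties
  using (toℕ-injective; toℕ-fromℕ<; toℕ<n; toℕ-inject₁; toℕ-fromℕ; splitAt-↑ˡ; splitAt-↑ʳ; splitAt⁻¹-↑ˡ; splitAt⁻¹-↑ʳ;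
         ↑ˡ-injective; ↑ʳ-injective)
open import Data.Sum as Sum using (_⊎_; inj₁; inj₂)
open import Data.Product as Product using (Σ; ∃-syntax; _×_; _,_; proj₁; proj₂)
open import Data.List using (List; []; _∷_; length; map)
open import Data.List.Membership.Propositional using (_∈_)
open import Data.List.Membership.Propositional.Properties using (∈-map⁺; ∈-map⁻)
open import Data.List.Membership.Propositional.Properties.WithK using (unique∧set⇒bag)
open import Data.List.Properties using (length-map)
open import Data.List.Relation.Binary.BagAndSetEquality using (∼bag⇒↭)
open import Data.List.Relation.Binary.Permutation.Propositional.Properties using (↭-length)
open import Data.List.Relation.Unary.All as All using (All; []; _∷_)
import Data.List.Relation.Unary.All.Properties as All
open import Data.List.Relation.Unary.AllPairs using ([]; _∷_)
open import Data.List.Relation.Unary.Any using (here; there)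
open import Data.List.Relation.Unary.Any.Properties using (singleton⁻)
open import Data.List.Relation.Unary.Unique.Propositional using (Unique)
import Data.List.Relation.Unary.Unique.Propositional.Properties as Unique
open import Data.Nat.Properties using (≤-refl; <-irrefl; 0≢1+n; <⇒≢; ≤-pred; ≤∧≢⇒<; n<1+n; m<n⇒m<1+n)
open import Data.Empty using (⊥; ⊥-elim)
open import Function using (_∘′_)
open import Function.Bundles using (_⇔_; mk⇔; Equivalence)
open import Relation.Binary.PropositionalEquality
open import Relation.Binary.Definitions using (DecidableEquality)
open import Relation.Nullary using (¬_; yes; no)
open import Relation.Binary.Construct.Closure.ReflexiveTransitive using (Star; ε; _◅_; _◅◅_; gmap)

open Equivalence using (to; from)

-- Finite cardinalities

-- Defs.Card for predicates on an arbitrary type: Card {n} is definitionally Card′ {Fin n}.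
Card′ : {A : Set} → (A → Set) → ℕ → Set
Card′ {A} P d = Σ (List A) λ l → Unique l × length l ≡ d × (∀ w → P w ⇔ (w ∈ l))

module _ {A : Set} where

  card-unique : ∀ {P : A → Set} {d e} → Card′ P d → Card′ P e → d ≡ e
  card-unique (l , !l , refl , P⇔l) (l′ , !l′ , refl , P⇔l′) =
    ↭-length (∼bag⇒↭ (unique∧set⇒bag !l !l′ λ {w} →
      mk⇔ (to (P⇔l′ w) ∘′ from (P⇔l w)) (to (P⇔l w) ∘′ from (P⇔l′ w))))

  card-cong : ∀ {P Q : A → Set} {d} → (∀ w → P w → Q w) → (∀ w → Q w → P w) → Card′ P d → Card′ Q d
  card-cong P⊆Q Q⊆P (l , !l , len , P⇔l) =
    l , !l , len , λ w → mk⇔ (λ q → to (P⇔l w) (Q⊆P w q)) (λ w∈l → P⊆Q w (from (P⇔l w) w∈l))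

  card-empty : ∀ {P : A → Set} → (∀ w → ¬ P w) → Card′ P 0
  card-empty ¬P = [] , [] , refl , λ w → mk⇔ (λ p → ⊥-elim (¬P w p)) λ ()

  card-singleton : ∀ (e : A) → Card′ (_≡ e) 1
  card-singleton e = e ∷ [] , [] ∷ [] , refl , λ w → mk⇔ here singleton⁻

  card-insert : DecidableEquality A → ∀ {Q : A → Set} {d} e → Q e →
                Card′ (λ w → Q w × w ≢ e) d → Card′ Q (suc d)
  card-insert _≟_ {Q} e Qe (l , !l , len , Q∖e⇔l) =
    e ∷ l , All.tabulate (λ {w} w∈l e≡w → proj₂ (from (Q∖e⇔l w) w∈l) (sym e≡w)) ∷ !l , cong suc len ,
    λ w → mk⇔ (to∈ w) (λ { (here refl) → Qe ; (there w∈l) → proj₁ (from (Q∖e⇔l w) w∈l) })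
    where
    to∈ : ∀ w → Q w → w ∈ e ∷ l
    to∈ w Qw with w ≟ e
    ... | yes w≡e = here w≡e
    ... | no w≢e = there (to (Q∖e⇔l w) (Qw , w≢e))

  card-1⇒singleton : ∀ {P : A → Set} → Card′ P 1 → ∃[ u ] (P u × ∀ w → P w → w ≡ u)
  card-1⇒singleton (u ∷ [] , _ , _ , P⇔l) =
    u , from (P⇔l u) (here refl) , λ w p → singleton⁻ (to (P⇔l w) p)

module _ {A B : Set} (g : A → B) (g-injective : ∀ {a b} → g a ≡ g b → a ≡ b) where

  card-image : ∀ {P : A → Set} {Q : B → Set} {d} →
               (∀ a → P a → Q (g a)) → (∀ w → Q w → ∃[ a ] (P a × w ≡ g a)) → Card′ P d → Card′ Q d
  card-image {Q = Q} P⇒Qg Q⇒gP (l , !l , len , P⇔l) =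
    map g l , Unique.map⁺ g-injective !l , trans (length-map g l) len ,
    λ w → mk⇔ (λ q → let a , p , w≡ga = Q⇒gP w q
                     in subst (_∈ map g l) (sym w≡ga) (∈-map⁺ g (to (P⇔l a) p)))
              (λ w∈gl → let a , a∈l , w≡ga = ∈-map⁻ g w∈gl
                         in subst Q (sym w≡ga) (P⇒Qg a (from (P⇔l a) a∈l)))

  private
    preimages : (l : List B) → All (λ b → ∃[ a ] (g a ≡ b)) l → List A
    preimages [] [] = []
    preimages (_ ∷ l) ((a , _) ∷ pre) = a ∷ preimages l pre

    g-preimages : ∀ l pre {a} → a ∈ preimages l pre → g a ∈ l
    g-preimages (_ ∷ l) ((a , ga≡b) ∷ pre) (here refl) = here ga≡b
    g-preimages (_ ∷ l) (_ ∷ pre) (there a∈) = there (g-preimages l pre a∈)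

    preimages-g : ∀ l pre {a} → g a ∈ l → a ∈ preimages l pre
    preimages-g (_ ∷ l) ((a′ , ga′≡b) ∷ pre) (here ga≡b) = here (g-injective (trans ga≡b (sym ga′≡b)))
    preimages-g (_ ∷ l) (_ ∷ pre) (there ga∈) = there (preimages-g l pre ga∈)

    length-preimages : ∀ l pre → length (preimages l pre) ≡ length l
    length-preimages [] [] = refl
    length-preimages (_ ∷ l) (_ ∷ pre) = cong suc (length-preimages l pre)

    unique-preimages : ∀ l pre → Unique l → Unique (preimages l pre)
    unique-preimages [] [] [] = []
    unique-preimages (b ∷ l) ((a , refl) ∷ pre) (b∉l ∷ !l) =
      All.tabulate (λ a′∈ a≡a′ → All.lookup b∉l (g-preimages l pre a′∈) (cong g a≡a′)) ∷
      unique-preimages l pre !l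

  card-preimage : ∀ {Q : B → Set} {d} → (∀ w → Q w → ∃[ a ] (g a ≡ w)) →
                  Card′ Q d → Card′ (λ a → Q (g a)) d
  card-preimage Q⇒image (l , !l , len , Q⇔l) =
    preimages l pre , unique-preimages l pre !l , trans (length-preimages l pre) len ,
    λ a → mk⇔ (λ q → preimages-g l pre (to (Q⇔l (g a)) q)) (λ a∈ → from (Q⇔l (g a)) (g-preimages l pre a∈))
    where
    pre : All (λ b → ∃[ a ] (g a ≡ b)) l
    pre = All.tabulate (λ {w} w∈l → Q⇒image w (from (Q⇔l w) w∈l))

unique-map-on : ∀ {A B : Set} {P : A → Set} {f : A → B} → (∀ {a b} → P a → P b → a ≢ b → f a ≢ f b) →
                ∀ {xs} → All P xs → Unique xs → Unique (map f xs)
unique-map-on f-inj [] [] = []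
unique-map-on f-inj (Pa ∷ Pxs) (a∉xs ∷ !xs) =
  All.map⁺ (All.zipWith (λ (Pb , a≢b) → f-inj Pa Pb a≢b) (Pxs , a∉xs)) ∷ unique-map-on f-inj Pxs !xs

pigeonhole-2 : ∀ {A : Set} {p q a b c : A} → a ≡ p ⊎ a ≡ q → b ≡ p ⊎ b ≡ q → c ≡ p ⊎ c ≡ q →
               a ≡ b ⊎ a ≡ c ⊎ b ≡ c
pigeonhole-2 (inj₁ refl) (inj₁ refl) _ = inj₁ refl
pigeonhole-2 (inj₂ refl) (inj₂ refl) _ = inj₁ refl
pigeonhole-2 (inj₁ refl) (inj₂ refl) (inj₁ refl) = inj₂ (inj₁ refl)
pigeonhole-2 (inj₁ refl) (inj₂ refl) (inj₂ refl) = inj₂ (inj₂ refl)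
pigeonhole-2 (inj₂ refl) (inj₁ refl) (inj₁ refl) = inj₂ (inj₂ refl)
pigeonhole-2 (inj₂ refl) (inj₁ refl) (inj₂ refl) = inj₂ (inj₁ refl)

-- Induced embeddings and gluing of graphs

record Embedding (H G : Graph) : Set where
  field
    embed           : Fin (V H) → Fin (V G)
    embed-injective : ∀ {a b} → embed a ≡ embed b → a ≡ b
    edge⁺           : ∀ {a b} → E H a b → E G (embed a) (embed b)
    edge⁻           : ∀ {a b} → E G (embed a) (embed b) → E H a b

module _ {H G : Graph} (ι : Embedding H G) where
  open Embedding ι

  star-embed : ∀ {S : VSet (V H)} {S′ : VSet (V G)} → (∀ a → S a → S′ (embed a)) →
               ∀ {a b} → Star (InducedEdge H S) a b → Star (InducedEdge G S′) (embed a) (embed b)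
  star-embed S⇒S′ = gmap embed λ (Sa , Sb , e) → S⇒S′ _ Sa , S⇒S′ _ Sb , edge⁺ e

  degree-embed : ∀ {a d} → (∀ w → E G (embed a) w → ∃[ b ] (w ≡ embed b)) →
                 Degree H a d → Degree G (embed a) d
  degree-embed {a} inside = card-image embed embed-injective (λ _ → edge⁺) λ w e →
    let b , w≡ = inside w e in b , edge⁻ (subst (E G (embed a)) w≡ e) , w≡

  degree-embed-suc : ∀ {a d z} → E G (embed a) z → (∀ b → z ≢ embed b) →
                     (∀ w → E G (embed a) w → w ≢ z → ∃[ b ] (w ≡ embed b)) →
                     Degree H a d → Degree G (embed a) (suc d)
  degree-embed-suc {a} e-z z∉ inside dg = card-insert Fin._≟_ _ e-z (card-image embed embed-injective
    (λ b e → edge⁺ e , λ eb≡z → z∉ b (sym eb≡z))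
    (λ w (e , w≢z) → let b , w≡ = inside w e w≢z in b , edge⁻ (subst (E G (embed a)) w≡ e) , w≡) dg)

  inducesCircle-embed : ∀ {S : VSet (V H)} {S′ : VSet (V G)} → (∀ a → S a → S′ (embed a)) →
                        (∀ v → S′ v → ∃[ a ] (S a × v ≡ embed a)) →
                        InducesCircle H S → InducesCircle G S′
  inducesCircle-embed {S} {S′} S⇒S′ S′⇒S (((a₀ , Sa₀) , connected) , degree) =
    ((embed a₀ , S⇒S′ a₀ Sa₀) , connected′) , degree′
    where
    connected′ : ∀ u v → S′ u → S′ v → Star (InducedEdge G S′) u v
    connected′ u v S′u S′v with S′⇒S u S′u | S′⇒S v S′v
    ... | a , Sa , refl | b , Sb , refl = star-embed S⇒S′ (connected a b Sa Sb)
    degree′ : ∀ u → S′ u → Card (λ w → S′ w × E G u w) 2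
    degree′ u S′u with S′⇒S u S′u
    ... | a , Sa , refl = card-image embed embed-injective (λ b (Sb , e) → S⇒S′ b Sb , edge⁺ e)
      (λ w (S′w , e) → let b , Sb , w≡ = S′⇒S w S′w in b , (Sb , edge⁻ (subst (E G (embed a)) w≡ e)) , w≡)
      (degree a Sa)

id-embedding : ∀ {G} → Embedding G G
id-embedding = record { embed = λ v → v ; embed-injective = λ eq → eq ; edge⁺ = λ e → e ; edge⁻ = λ e → e }

isCircle⇒inducesCircle : ∀ {G} → IsCircle G → InducesCircle G (λ _ → Fin 1)
isCircle⇒inducesCircle (_ , connected , degree) =
  connected , λ u _ → card-cong (λ _ e → 0F , e) (λ _ → proj₂) (degree u)

star-mono : ∀ {G} {S S′ : VSet (V G)} → (∀ w → S w → S′ w) →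
            ∀ {u v} → Star (InducedEdge G S) u v → Star (InducedEdge G S′) u v
star-mono = star-embed id-embedding

star-crossing : ∀ {G} {P Q : VSet (V G)} → (∀ w → P w → ¬ Q w) →
                ∀ {u v} → Star (InducedEdge G (λ w → P w ⊎ Q w)) u v → P u → Q v →
                ∃[ a ] ∃[ b ] (P a × Q b × E G a b)
star-crossing disjoint ε Pu Qu = ⊥-elim (disjoint _ Pu Qu)
star-crossing disjoint ((_ , inj₁ Pw , _) ◅ path) _ Qv = star-crossing disjoint path Pw Qv
star-crossing disjoint ((_ , inj₂ Qw , e) ◅ _) Pu _ = _ , _ , Pu , Qw , e

data Side (n m : ℕ) : Fin (n + m) → Set where
  left  : (a : Fin n) → Side n m (a ↑ˡ m)
  right : (b : Fin m) → Side n m (n ↑ʳ b)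

side : ∀ n m v → Side n m v
side n m v with splitAt n v in eq
... | inj₁ a = subst (Side n m) (splitAt⁻¹-↑ˡ eq) (left a)
... | inj₂ b = subst (Side n m) (splitAt⁻¹-↑ʳ eq) (right b)

↑ˡ≢↑ʳ : ∀ {n m} (a : Fin n) (b : Fin m) → a ↑ˡ m ≢ n ↑ʳ b
↑ˡ≢↑ʳ {n} {m} a b eq with trans (sym (splitAt-↑ˡ n a m)) (trans (cong (splitAt n) eq) (splitAt-↑ʳ n m b))
... | ()

module Glue (G : Graph) (x : Fin (V G)) (H : Graph) (y : Fin (V H)) where
  private
    n m : ℕ
    n = V G
    m = V H
    GH : Graph
    GH = glue G x H y

  inl : Embedding G GH
  inl = record
    { embed = _↑ˡ m ; embed-injective = ↑ˡ-injective m _ _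
    ; edge⁺ = λ {a} {b} → ⁺ a b ; edge⁻ = λ {a} {b} → ⁻ a b }
    where
    ⁺ : ∀ a b → E G a b → E GH (a ↑ˡ m) (b ↑ˡ m)
    ⁺ a b rewrite splitAt-↑ˡ n a m | splitAt-↑ˡ n b m = λ e → e
    ⁻ : ∀ a b → E GH (a ↑ˡ m) (b ↑ˡ m) → E G a b
    ⁻ a b rewrite splitAt-↑ˡ n a m | splitAt-↑ˡ n b m = λ e → e

  inr : Embedding H GH
  inr = record
    { embed = n ↑ʳ_ ; embed-injective = ↑ʳ-injective n _ _
    ; edge⁺ = λ {a} {b} → ⁺ a b ; edge⁻ = λ {a} {b} → ⁻ a b }
    where
    ⁺ : ∀ a b → E H a b → E GH (n ↑ʳ a) (n ↑ʳ b)
    ⁺ a b rewrite splitAt-↑ʳ n m a | splitAt-↑ʳ n m b = λ e → e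
    ⁻ : ∀ a b → E GH (n ↑ʳ a) (n ↑ʳ b) → E H a b
    ⁻ a b rewrite splitAt-↑ʳ n m a | splitAt-↑ʳ n m b = λ e → e

  bridge : E GH (x ↑ˡ m) (n ↑ʳ y)
  bridge rewrite splitAt-↑ˡ n x m | splitAt-↑ʳ n m y = refl , refl

  bridge⁻ : E GH (n ↑ʳ y) (x ↑ˡ m)
  bridge⁻ rewrite splitAt-↑ˡ n x m | splitAt-↑ʳ n m y = refl , refl

  bridge-ends : ∀ {a b} → E GH (a ↑ˡ m) (n ↑ʳ b) → a ≡ x × b ≡ y
  bridge-ends {a} {b} rewrite splitAt-↑ˡ n a m | splitAt-↑ʳ n m b = λ e → e

  bridge-ends⁻ : ∀ {a b} → E GH (n ↑ʳ b) (a ↑ˡ m) → a ≡ x × b ≡ y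
  bridge-ends⁻ {a} {b} rewrite splitAt-↑ˡ n a m | splitAt-↑ʳ n m b = λ e → e

  degree-↑ˡ : ∀ {a d} → a ≢ x → Degree G a d → Degree GH (a ↑ˡ m) d
  degree-↑ˡ {a} a≢x = degree-embed inl inside
    where
    inside : ∀ w → E GH (a ↑ˡ m) w → ∃[ b ] (w ≡ b ↑ˡ m)
    inside w e with side n m w
    ... | left b = b , refl
    ... | right b = ⊥-elim (a≢x (proj₁ (bridge-ends e)))

  degree-↑ʳ : ∀ {b d} → b ≢ y → Degree H b d → Degree GH (n ↑ʳ b) d
  degree-↑ʳ {b} b≢y = degree-embed inr inside
    where
    inside : ∀ w → E GH (n ↑ʳ b) w → ∃[ c ] (w ≡ n ↑ʳ c)
    inside w e with side n m w
    ... | left a = ⊥-elim (b≢y (proj₂ (bridge-ends⁻ e)))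
    ... | right c = c , refl

  degree-x : ∀ {d} → Degree G x d → Degree GH (x ↑ˡ m) (suc d)
  degree-x = degree-embed-suc inl bridge (λ b eq → ↑ˡ≢↑ʳ b y (sym eq)) inside
    where
    inside : ∀ w → E GH (x ↑ˡ m) w → w ≢ n ↑ʳ y → ∃[ b ] (w ≡ b ↑ˡ m)
    inside w e w≢ with side n m w
    ... | left b = b , refl
    ... | right b = ⊥-elim (w≢ (cong (n ↑ʳ_) (proj₂ (bridge-ends e))))

  degree-y : ∀ {d} → Degree H y d → Degree GH (n ↑ʳ y) (suc d)
  degree-y = degree-embed-suc inr bridge⁻ (λ b → ↑ˡ≢↑ʳ x b) inside
    where
    inside : ∀ w → E GH (n ↑ʳ y) w → w ≢ x ↑ˡ m → ∃[ c ] (w ≡ n ↑ʳ c)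
    inside w e w≢ with side n m w
    ... | left a = ⊥-elim (w≢ (cong (_↑ˡ m) (proj₁ (bridge-ends⁻ e))))
    ... | right c = c , refl

  glue-connected : Connected G → Connected H → Connected GH
  glue-connected ((a₀ , _) , pathG) (_ , pathH) = (a₀ ↑ˡ m , 0F) , path
    where
    inG : ∀ a b → Star (InducedEdge GH (λ _ → Fin 1)) (a ↑ˡ m) (b ↑ˡ m)
    inG a b = star-embed inl (λ _ s → s) (pathG a b 0F 0F)
    inH : ∀ a b → Star (InducedEdge GH (λ _ → Fin 1)) (n ↑ʳ a) (n ↑ʳ b)
    inH a b = star-embed inr (λ _ s → s) (pathH a b 0F 0F)
    path : ∀ u v → Fin 1 → Fin 1 → Star (InducedEdge GH (λ _ → Fin 1)) u v
    path u v _ _ with side n m u | side n m v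
    ... | left a  | left b  = inG a b
    ... | right a | right b = inH a b
    ... | left a  | right b = inG a x ◅◅ (0F , 0F , bridge) ◅ inH y b
    ... | right a | left b  = inH a y ◅◅ (0F , 0F , bridge⁻) ◅ inG x b

-- Circle-trees

partℕ : ∀ {k} (t : CircleTree k) → Fin (V (tree t)) → ℕ
partℕ t v = toℕ (part t v)

partℕ< : ∀ {k} (t : CircleTree k) v → partℕ t v < k
partℕ< t v = toℕ<n (part t v)

2≢3 : 2 ≢ 3
2≢3 ()

degree-2-or-3 : ∀ {k} (t : CircleTree k) v → Degree (tree t) v 2 ⊎ Degree (tree t) v 3
degree-2-or-3 (base C (_ , _ , degree)) v = inj₁ (degree v)
degree-2-or-3 (step t C (_ , _ , degree) x dx y) v = cases (side (V (tree t)) (V C) v)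
  where
  open Glue (tree t) x C y
  cases : ∀ {v} → Side (V (tree t)) (V C) v → Degree (glue (tree t) x C y) v 2 ⊎ Degree (glue (tree t) x C y) v 3
  cases (left a) with a Fin.≟ x
  ... | yes refl = inj₂ (degree-x dx)
  ... | no a≢x = Sum.map (degree-↑ˡ a≢x) (degree-↑ˡ a≢x) (degree-2-or-3 t a)
  cases (right b) with b Fin.≟ y
  ... | yes refl = inj₂ (degree-y (degree y))
  ... | no b≢y = inj₁ (degree-↑ʳ b≢y (degree b))

-- Q_T described combinatorially, with circles indexed by ℕ so that an index names the same circle
-- after later steps: the step adding C(k) makes it adjacent exactly to the circle containing x.
Adj : ∀ {k} → CircleTree k → ℕ → ℕ → Set
Adj (base _ _) _ _ = ⊥
Adj (step {k} t _ _ x _ _) i j = Adj t i j ⊎ (i ≡ k × j ≡ partℕ t x) ⊎ (j ≡ k × i ≡ partℕ t x)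

qdegree : ∀ {k} → CircleTree k → ℕ → ℕ
qdegree (base _ _) i = 0
qdegree (step {k} t _ _ x _ _) i with i ≟ k | i ≟ partℕ t x
... | yes _ | _     = 1
... | no _  | yes _ = suc (qdegree t i)
... | no _  | no _  = qdegree t i

Adj-bounded : ∀ {k} (t : CircleTree k) {i j} → Adj t i j → i < k × j < k
Adj-bounded (step {k} t _ _ x _ _) (inj₁ adj) = Product.map m<n⇒m<1+n m<n⇒m<1+n (Adj-bounded t adj)
Adj-bounded (step {k} t _ _ x _ _) (inj₂ (inj₁ (refl , refl))) = n<1+n k , m<n⇒m<1+n (partℕ< t x)
Adj-bounded (step {k} t _ _ x _ _) (inj₂ (inj₂ (refl , refl))) = m<n⇒m<1+n (partℕ< t x) , n<1+n k

Adj-sym : ∀ {k} (t : CircleTree k) {i j} → Adj t i j → Adj t j i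
Adj-sym (step t _ _ _ _ _) (inj₁ adj) = inj₁ (Adj-sym t adj)
Adj-sym (step t _ _ _ _ _) (inj₂ (inj₁ p)) = inj₂ (inj₂ p)
Adj-sym (step t _ _ _ _ _) (inj₂ (inj₂ p)) = inj₂ (inj₁ p)

Adj-irrefl : ∀ {k} (t : CircleTree k) {i} → ¬ Adj t i i
Adj-irrefl (step t _ _ _ _ _) (inj₁ adj) = Adj-irrefl t adj
Adj-irrefl (step t _ _ x _ _) (inj₂ (inj₁ (refl , k≡px))) = <-irrefl (sym k≡px) (partℕ< t x)
Adj-irrefl (step t _ _ x _ _) (inj₂ (inj₂ (refl , k≡px))) = <-irrefl (sym k≡px) (partℕ< t x)

Adj-count : ∀ {k} (t : CircleTree k) i → Card′ (Adj t i) (qdegree t i)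
Adj-count (base _ _) i = card-empty λ _ ()
Adj-count (step {k} t C ic x dx y) i with i ≟ k | i ≟ partℕ t x
... | yes refl | _ = card-cong (λ { j refl → inj₂ (inj₁ (refl , refl)) }) only-px (card-singleton _)
  where
  only-px : ∀ j → Adj (step t C ic x dx y) k j → j ≡ partℕ t x
  only-px j (inj₁ adj) = ⊥-elim (<-irrefl refl (proj₁ (Adj-bounded t adj)))
  only-px j (inj₂ (inj₁ (_ , j≡px))) = j≡px
  only-px j (inj₂ (inj₂ (_ , k≡px))) = ⊥-elim (<-irrefl (sym k≡px) (partℕ< t x))
... | no i≢k | yes refl = card-insert _≟_ k (inj₂ (inj₂ (refl , refl))) (card-cong old⁺ old⁻ (Adj-count t i))
  where
  old⁺ : ∀ j → Adj t i j → Adj (step t C ic x dx y) i j × j ≢ k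
  old⁺ j adj = inj₁ adj , λ { refl → <-irrefl refl (proj₂ (Adj-bounded t adj)) }
  old⁻ : ∀ j → Adj (step t C ic x dx y) i j × j ≢ k → Adj t i j
  old⁻ j (inj₁ adj , _) = adj
  old⁻ j (inj₂ (inj₁ (i≡k , _)) , _) = ⊥-elim (i≢k i≡k)
  old⁻ j (inj₂ (inj₂ (j≡k , _)) , j≢k) = ⊥-elim (j≢k j≡k)
... | no i≢k | no i≢px = card-cong (λ _ → inj₁) old (Adj-count t i)
  where
  old : ∀ j → Adj (step t C ic x dx y) i j → Adj t i j
  old j (inj₁ adj) = adj
  old j (inj₂ (inj₁ (i≡k , _))) = ⊥-elim (i≢k i≡k)
  old j (inj₂ (inj₂ (_ , i≡px))) = ⊥-elim (i≢px i≡px)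

Leaf : ∀ {k} → CircleTree k → ℕ → Set
Leaf t l = qdegree t l ≡ 1

Leaf⇒< : ∀ {k} (t : CircleTree k) {l} → Leaf t l → l < k
Leaf⇒< t {l} leaf = let _ , adj , _ = card-1⇒singleton (subst (Card′ (Adj t l)) leaf (Adj-count t l))
                    in proj₁ (Adj-bounded t adj)

module Step {k} (t : CircleTree k) (C : Graph) (ic : IsCircle C)
            (x : Fin (V (tree t))) (dx : Degree (tree t) x 2) (y : Fin (V C)) where
  open Glue (tree t) x C y public
  private
    n m : ℕ
    n = V (tree t)
    m = V C
    t′ : CircleTree (suc k)
    t′ = step t C ic x dx y
    px : ℕ
    px = partℕ t x

  partℕ-↑ˡ : ∀ a → partℕ t′ (a ↑ˡ m) ≡ partℕ t a
  partℕ-↑ˡ a rewrite splitAt-↑ˡ n a m = toℕ-inject₁ (part t a)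

  partℕ-↑ʳ : ∀ b → partℕ t′ (n ↑ʳ b) ≡ k
  partℕ-↑ʳ b rewrite splitAt-↑ʳ n m b = toℕ-fromℕ k

  in-new-circle : ∀ {w} → partℕ t′ w ≡ k → ∃[ b ] (w ≡ n ↑ʳ b)
  in-new-circle {w} pw with side n m w
  ... | left a = ⊥-elim (<-irrefl (trans (sym (partℕ-↑ˡ a)) pw) (partℕ< t a))
  ... | right b = b , refl

  in-old-circle : ∀ {w c} → partℕ t′ w ≡ c → c ≢ k → ∃[ a ] (partℕ t a ≡ c × w ≡ a ↑ˡ m)
  in-old-circle {w} pw c≢k with side n m w
  ... | left a = a , trans (sym (partℕ-↑ˡ a)) pw , refl
  ... | right b = ⊥-elim (c≢k (trans (sym pw) (partℕ-↑ʳ b)))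

  degree-3-↑ˡ⁻ : ∀ {a} → a ≢ x → Degree (tree t′) (a ↑ˡ m) 3 → Degree (tree t) a 3
  degree-3-↑ˡ⁻ {a} a≢x d3 with degree-2-or-3 t a
  ... | inj₁ d2 = ⊥-elim (2≢3 (card-unique (degree-↑ˡ a≢x d2) d3))
  ... | inj₂ d3′ = d3′

  degree-3-↑ʳ⁻ : ∀ {b} → Degree (tree t′) (n ↑ʳ b) 3 → b ≡ y
  degree-3-↑ʳ⁻ {b} d3 with b Fin.≟ y
  ... | yes b≡y = b≡y
  ... | no b≢y = ⊥-elim (2≢3 (card-unique (degree-↑ʳ b≢y (proj₂ (proj₂ ic) b)) d3))

  degree-3-old : ∀ {c d} → c ≢ k → Card (λ a → partℕ t a ≡ c × Degree (tree t) a 3) d →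
                 Card (λ w → (partℕ t′ w ≡ c × Degree (tree t′) w 3) × w ≢ x ↑ˡ m) d
  degree-3-old {c} c≢k = card-image (_↑ˡ m) (↑ˡ-injective m _ _) new old
    where
    new : ∀ a → partℕ t a ≡ c × Degree (tree t) a 3 →
          (partℕ t′ (a ↑ˡ m) ≡ c × Degree (tree t′) (a ↑ˡ m) 3) × a ↑ˡ m ≢ x ↑ˡ m
    new a (pa , d3) = (trans (partℕ-↑ˡ a) pa , degree-↑ˡ a≢x d3) , λ eq → a≢x (↑ˡ-injective m a x eq)
      where a≢x : a ≢ x
            a≢x refl = 2≢3 (card-unique dx d3)
    old : ∀ w → (partℕ t′ w ≡ c × Degree (tree t′) w 3) × w ≢ x ↑ˡ m →
          ∃[ a ] ((partℕ t a ≡ c × Degree (tree t) a 3) × w ≡ a ↑ˡ m)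
    old w ((pw , d3) , w≢x) with in-old-circle pw c≢k
    ... | a , pa , refl = a , (pa , degree-3-↑ˡ⁻ (λ { refl → w≢x refl }) d3) , refl

  qdegree-new : qdegree t′ k ≡ 1
  qdegree-new with k ≟ k
  ... | yes _ = refl
  ... | no k≢k = ⊥-elim (k≢k refl)

  qdegree-attached : qdegree t′ px ≡ suc (qdegree t px)
  qdegree-attached with px ≟ k | px ≟ px
  ... | yes px≡k | _ = ⊥-elim (<-irrefl px≡k (partℕ< t x))
  ... | no _ | yes _ = refl
  ... | no _ | no px≢px = ⊥-elim (px≢px refl)

  qdegree-old : ∀ {c} → c ≢ k → c ≢ px → qdegree t′ c ≡ qdegree t c
  qdegree-old {c} c≢k c≢px with c ≟ k | c ≟ px
  ... | yes c≡k | _ = ⊥-elim (c≢k c≡k)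
  ... | no _ | yes c≡px = ⊥-elim (c≢px c≡px)
  ... | no _ | no _ = refl

  Leaf-old : ∀ {l} → Leaf t l → l ≢ px → Leaf t′ l
  Leaf-old {l} leaf l≢px = trans (qdegree-old (<⇒≢ (Leaf⇒< t leaf)) l≢px) leaf

  -- If px was a leaf, the new circle C(k) hangs off it and takes over its role as a leaf.
  successor-leaf : ℕ → ℕ
  successor-leaf l with l ≟ px
  ... | yes _ = k
  ... | no _ = l

  Leaf-successor : ∀ {l} → Leaf t l → Leaf t′ (successor-leaf l)
  Leaf-successor {l} leaf with l ≟ px
  ... | yes _ = qdegree-new
  ... | no l≢px = Leaf-old leaf l≢px

  successor-leaf-≢ : ∀ {l c} → l ≢ c → c ≢ k → successor-leaf l ≢ c
  successor-leaf-≢ {l} l≢c c≢k with l ≟ px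
  ... | yes _ = λ k≡c → c≢k (sym k≡c)
  ... | no _ = l≢c

  successor-leaf-injective : ∀ {l l′} → Leaf t l → Leaf t l′ → l ≢ l′ → successor-leaf l ≢ successor-leaf l′
  successor-leaf-injective {l} {l′} leaf leaf′ l≢l′ with l ≟ px | l′ ≟ px
  ... | yes refl | yes refl = ⊥-elim (l≢l′ refl)
  ... | yes _ | no _ = λ k≡l′ → <-irrefl (sym k≡l′) (Leaf⇒< t leaf′)
  ... | no _ | yes _ = λ l≡k → <-irrefl l≡k (Leaf⇒< t leaf)
  ... | no _ | no _ = l≢l′

degree-3-count : ∀ {k} (t : CircleTree k) c → Card (λ v → partℕ t v ≡ c × Degree (tree t) v 3) (qdegree t c)
degree-3-count (base C (_ , _ , degree)) c = card-empty λ v (_ , d3) → 2≢3 (card-unique (degree v) d3)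
degree-3-count (step {k} t C ic x dx y) c with c ≟ k | c ≟ partℕ t x
... | yes refl | _ =
  card-cong (λ { w refl → partℕ-↑ʳ y , degree-y (proj₂ (proj₂ ic) y) }) only-y (card-singleton _)
  where
  open Step t C ic x dx y
  only-y : ∀ w → partℕ (step t C ic x dx y) w ≡ k × Degree (tree (step t C ic x dx y)) w 3 → w ≡ V (tree t) ↑ʳ y
  only-y w (pw , d3) with in-new-circle pw
  ... | b , refl = cong (V (tree t) ↑ʳ_) (degree-3-↑ʳ⁻ d3)
... | no c≢k | yes refl = card-insert Fin._≟_ _ (partℕ-↑ˡ x , degree-x dx) (degree-3-old c≢k (degree-3-count t c))
  where open Step t C ic x dx y
... | no c≢k | no c≢px =
  card-cong (λ _ → proj₁) (λ w Qw → Qw , λ { refl → c≢px (trans (sym (proj₁ Qw)) (partℕ-↑ˡ x)) })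
            (degree-3-old c≢k (degree-3-count t c))
  where open Step t C ic x dx y

circle-induces-circle : ∀ {k} (t : CircleTree k) c → c < k → InducesCircle (tree t) (λ v → partℕ t v ≡ c)
circle-induces-circle (base C ic) zero _ =
  inducesCircle-embed id-embedding (λ _ _ → refl) (λ v _ → v , 0F , refl) (isCircle⇒inducesCircle ic)
circle-induces-circle (base C ic) (suc c) (s≤s ())
circle-induces-circle (step {k} t C ic x dx y) c c<1+k with c ≟ k
... | yes refl = inducesCircle-embed inr (λ b _ → partℕ-↑ʳ b)
                   (λ v pv → let b , v≡ = in-new-circle pv in b , 0F , v≡) (isCircle⇒inducesCircle ic)
  where open Step t C ic x dx y
... | no c≢k = inducesCircle-embed inl (λ a pa → trans (partℕ-↑ˡ a) pa) (λ v pv → in-old-circle pv c≢k)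
                 (circle-induces-circle t c (≤∧≢⇒< (≤-pred c<1+k) c≢k))
  where open Step t C ic x dx y

circle-nonempty : ∀ {k} (t : CircleTree k) c → c < k → ∃[ v ] (partℕ t v ≡ c)
circle-nonempty t c c<k = proj₁ (proj₁ (circle-induces-circle t c c<k))

tree-connected : ∀ {k} (t : CircleTree k) → Connected (tree t)
tree-connected (base C (_ , connected , _)) = connected
tree-connected (step t C (_ , connected , _) x _ y) = Glue.glue-connected (tree t) x C y (tree-connected t) connected

Adj⇒edge : ∀ {k} (t : CircleTree k) {i j} → Adj t i j →
           ∃[ a ] ∃[ b ] (partℕ t a ≡ i × partℕ t b ≡ j × E (tree t) a b)
Adj⇒edge (step t C ic x dx y) (inj₁ adj) =
  let a , b , pa , pb , e = Adj⇒edge t adj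
  in a ↑ˡ V C , b ↑ˡ V C , trans (partℕ-↑ˡ a) pa , trans (partℕ-↑ˡ b) pb , Embedding.edge⁺ inl e
  where open Step t C ic x dx y
Adj⇒edge (step t C ic x dx y) (inj₂ (inj₁ (refl , refl))) = _ , _ , partℕ-↑ʳ y , partℕ-↑ˡ x , bridge⁻
  where open Step t C ic x dx y
Adj⇒edge (step t C ic x dx y) (inj₂ (inj₂ (refl , refl))) = _ , _ , partℕ-↑ˡ x , partℕ-↑ʳ y , bridge
  where open Step t C ic x dx y

edge⇒Adj : ∀ {k} (t : CircleTree k) {a b} → E (tree t) a b → partℕ t a ≢ partℕ t b →
           Adj t (partℕ t a) (partℕ t b)
edge⇒Adj (base _ _) _ different = different refl
edge⇒Adj (step {k} t C ic x dx y) {v} {w} = cases (side (V (tree t)) (V C) v) (side (V (tree t)) (V C) w)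
  where
  open Step t C ic x dx y
  t′ : CircleTree (suc k)
  t′ = step t C ic x dx y
  cases : ∀ {v w} → Side (V (tree t)) (V C) v → Side (V (tree t)) (V C) w →
          E (tree t′) v w → partℕ t′ v ≢ partℕ t′ w → Adj t′ (partℕ t′ v) (partℕ t′ w)
  cases (left a) (left b) e different rewrite partℕ-↑ˡ a | partℕ-↑ˡ b =
    inj₁ (edge⇒Adj t (Embedding.edge⁻ inl e) different)
  cases (right a) (right b) e different = ⊥-elim (different (trans (partℕ-↑ʳ a) (sym (partℕ-↑ʳ b))))
  cases (left a) (right b) e _ rewrite partℕ-↑ˡ a | partℕ-↑ʳ b =
    inj₂ (inj₂ (refl , cong (partℕ t) (proj₁ (bridge-ends e))))
  cases (right b) (left a) e _ rewrite partℕ-↑ˡ a | partℕ-↑ʳ b =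
    inj₂ (inj₁ (refl , cong (partℕ t) (proj₁ (bridge-ends⁻ e))))

-- The quotient Q_T

module _ {k} (t : CircleTree k) where
  private
    T : Graph
    T = tree t

  circle-member : ∀ i → ∃[ a ] (part t a ≡ i)
  circle-member i = let a , pa = circle-nonempty t (toℕ i) (toℕ<n i) in a , toℕ-injective pa

  path-within-circle : ∀ {S : VSet (V T)} c → (∀ w → partℕ t w ≡ c → S w) →
                       ∀ {u v} → partℕ t u ≡ c → partℕ t v ≡ c → Star (InducedEdge T S) u v
  path-within-circle c inside {u} {v} refl pv =
    star-mono inside (proj₂ (proj₁ (circle-induces-circle t c (partℕ< t u))) u v refl pv)

  path-across-Adj : ∀ {S : VSet (V T)} {c d} → Adj t c d →
                    (∀ w → partℕ t w ≡ c → S w) → (∀ w → partℕ t w ≡ d → S w) →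
                    ∀ {u v} → partℕ t u ≡ c → partℕ t v ≡ d → Star (InducedEdge T S) u v
  path-across-Adj adj inside-c inside-d pu pv =
    let a , b , pa , pb , e = Adj⇒edge t adj
    in path-within-circle _ inside-c pu pa ◅◅ (inside-c a pa , inside-d b pb , e) ◅ path-within-circle _ inside-d pb pv

  quotient-edge⇒Adj : ∀ {i j} → E (quotient t) i j → Adj t (toℕ i) (toℕ j)
  quotient-edge⇒Adj {i} {j} (i≢j , _ , connected) =
    let a , pa = circle-member i
        b , pb = circle-member j
        a′ , b′ , pa′ , pb′ , e = star-crossing disjoint (connected a b (inj₁ pa) (inj₂ pb)) pa pb
    in subst₂ (Adj t) (cong toℕ pa′) (cong toℕ pb′)
              (edge⇒Adj t e λ eq → i≢j (trans (sym pa′) (trans (toℕ-injective eq) pb′)))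
    where
    disjoint : ∀ w → part t w ≡ i → part t w ≢ j
    disjoint w refl = i≢j

  Adj⇒quotient-edge : ∀ {i j} → Adj t (toℕ i) (toℕ j) → E (quotient t) i j
  Adj⇒quotient-edge {i} {j} adj =
    (λ { refl → Adj-irrefl t adj }) , (proj₁ (circle-member i) , inj₁ (proj₂ (circle-member i))) , connected
    where
    U : VSet (V T)
    U w = part t w ≡ i ⊎ part t w ≡ j
    inside-i : ∀ w → partℕ t w ≡ toℕ i → U w
    inside-i w pw = inj₁ (toℕ-injective pw)
    inside-j : ∀ w → partℕ t w ≡ toℕ j → U w
    inside-j w pw = inj₂ (toℕ-injective pw)
    connected : ∀ u v → U u → U v → Star (InducedEdge T U) u v
    connected u v (inj₁ refl) (inj₁ pv) = path-within-circle _ inside-i refl (cong toℕ pv)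
    connected u v (inj₂ refl) (inj₂ pv) = path-within-circle _ inside-j refl (cong toℕ pv)
    connected u v (inj₁ refl) (inj₂ pv) = path-across-Adj adj inside-i inside-j refl (cong toℕ pv)
    connected u v (inj₂ refl) (inj₁ pv) = path-across-Adj (Adj-sym t adj) inside-j inside-i refl (cong toℕ pv)

  quotient-degree : ∀ c → Degree (quotient t) c (qdegree t (toℕ c))
  quotient-degree c = card-cong (λ _ → Adj⇒quotient-edge) (λ _ → quotient-edge⇒Adj)
    (card-preimage toℕ toℕ-injective (λ j adj → fromℕ< (proj₂ (Adj-bounded t adj)) , toℕ-fromℕ< _)
                   (Adj-count t (toℕ c)))

  Leaf⇒quotient-degree<2 : ∀ c → Leaf t (toℕ c) → ∃[ d ] (d < 2 × Degree (quotient t) c d)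
  Leaf⇒quotient-degree<2 c leaf = 1 , ≤-refl , subst (Degree (quotient t) c) leaf (quotient-degree c)

  quotient-simple : Simple (quotient t)
  quotient-simple = (λ _ _ e → Adj⇒quotient-edge (Adj-sym t (quotient-edge⇒Adj e))) , λ _ (i≢i , _) → i≢i refl

  project-path : ∀ {u v} → Star (InducedEdge T (λ _ → Fin 1)) u v →
                 Star (InducedEdge (quotient t) (λ _ → Fin 1)) (part t u) (part t v)
  project-path ε = ε
  project-path {u} (_◅_ {j = w} (_ , _ , e) path) with part t u Fin.≟ part t w
  ... | yes same = subst (λ c → Star _ c _) (sym same) (project-path path)
  ... | no different = (0F , 0F , Adj⇒quotient-edge (edge⇒Adj t e (different ∘′ toℕ-injective))) ◅ project-path path

  quotient-connected : Connected (quotient t)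
  quotient-connected with tree-connected t
  ... | (a₀ , _) , path = (part t a₀ , 0F) , λ i j _ _ →
    let a , pa = circle-member i
        b , pb = circle-member j
    in subst₂ (Star _) pa pb (project-path (path a b 0F 0F))

-- Leaves of Q_T and P-vertices

LeavesBesides : ∀ {k} → CircleTree k → ℕ → ℕ → Set
LeavesBesides t c d = ∃[ ls ] (Unique ls × length ls ≡ d × All (λ l → Leaf t l × l ≢ c) ls)

-- Each of the qdegree t c branches of Q_T at c ends in a leaf.
distinct-leaves : ∀ {k} (t : CircleTree k) c → LeavesBesides t c (qdegree t c)
distinct-leaves (base _ _) c = [] , [] , refl , []
distinct-leaves (step {k} t C ic x dx y) c with c ≟ k | c ≟ partℕ t x
... | yes refl | _ = new-circle (distinct-leaves t (partℕ t x))
  where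
  open Step t C ic x dx y
  px≢k : partℕ t x ≢ k
  px≢k = <⇒≢ (partℕ< t x)
  new-circle : LeavesBesides t (partℕ t x) (qdegree t (partℕ t x)) → LeavesBesides (step t C ic x dx y) k 1
  new-circle ([] , _ , len , _) =
    _ ∷ [] , [] ∷ [] , refl , (trans qdegree-attached (cong suc (sym len)) , px≢k) ∷ []
  new-circle (l ∷ _ , _ , _ , (leaf , l≢px) ∷ _) =
    l ∷ [] , [] ∷ [] , refl , (Leaf-old leaf l≢px , <⇒≢ (Leaf⇒< t leaf)) ∷ []
... | no c≢k | yes refl =
  let ls , !ls , len , leaves = distinct-leaves t c
  in k ∷ ls , All.map (λ (leaf , _) k≡l → <-irrefl (sym k≡l) (Leaf⇒< t leaf)) leaves ∷ !ls , cong suc len ,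
     (qdegree-new , λ k≡c → c≢k (sym k≡c)) ∷ All.map (λ (leaf , l≢c) → Leaf-old leaf l≢c , l≢c) leaves
  where open Step t C ic x dx y
... | no c≢k | no c≢px =
  let ls , !ls , len , leaves = distinct-leaves t c
  in map successor-leaf ls ,
     unique-map-on (λ (leaf , _) (leaf′ , _) → successor-leaf-injective leaf leaf′) leaves !ls ,
     trans (length-map successor-leaf ls) len ,
     All.map⁺ (All.map (λ (leaf , l≢c) → Leaf-successor leaf , successor-leaf-≢ l≢c c≢k) leaves)
  where open Step t C ic x dx y

another-leaf : ∀ {k} (t : CircleTree k) {c} → Leaf t c → ∃[ l ] (Leaf t l × l ≢ c)
another-leaf t {c} leaf with distinct-leaves t c
... | [] , _ , len , _ = ⊥-elim (0≢1+n (trans len leaf))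
... | l ∷ _ , _ , _ , leaf-l ∷ _ = l , leaf-l

UniqueDegree3In : ∀ {k} (t : CircleTree k) → Fin k → Set
UniqueDegree3In t j =
  ∃[ u ] (part t u ≡ j × Degree (tree t) u 3 × (∀ w → part t w ≡ j → Degree (tree t) w 3 → w ≡ u))

Leaf⇒unique-degree-3 : ∀ {k} (t : CircleTree k) {c} → Leaf t c →
                       ∃[ u ] (partℕ t u ≡ c × Degree (tree t) u 3 × (∀ w → partℕ t w ≡ c → Degree (tree t) w 3 → w ≡ u))
Leaf⇒unique-degree-3 t {c} leaf =
  let u , (pu , d3) , unique = card-1⇒singleton (subst (Card _) leaf (degree-3-count t c))
  in u , pu , d3 , λ w pw d3′ → unique w (pw , d3′)

Leaf⇒UniqueDegree3In : ∀ {k} (t : CircleTree k) j → Leaf t (toℕ j) → UniqueDegree3In t j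
Leaf⇒UniqueDegree3In t j leaf =
  let u , pu , d3 , unique = Leaf⇒unique-degree-3 t leaf
  in u , toℕ-injective pu , d3 , λ w pw d3′ → unique w (cong toℕ pw) d3′

Leaf⇒PVertex : ∀ {k} (t : CircleTree k) {c} → Leaf t c → ∃[ u ] (partℕ t u ≡ c × IsPVertex (tree t) u)
Leaf⇒PVertex t {c} leaf with Leaf⇒unique-degree-3 t leaf
... | u , pu , d3 , unique =
  u , pu , d3 , (λ v → partℕ t v ≡ c) , circle-induces-circle t c (Leaf⇒< t leaf) , pu ,
  λ w pw w≢u → Sum.fromInj₁ (λ d3′ → ⊥-elim (w≢u (unique w pw d3′))) (degree-2-or-3 t w)

distinct-PVertices : ∀ {k} (t : CircleTree k) {l l′} → Leaf t l → Leaf t l′ → l ≢ l′ →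
                     ∃[ p ] ∃[ q ] (p ≢ q × IsPVertex (tree t) p × IsPVertex (tree t) q)
distinct-PVertices t leaf leaf′ l≢l′ with Leaf⇒PVertex t leaf | Leaf⇒PVertex t leaf′
... | u , refl , Pu | u′ , refl , Pu′ = u , u′ , (λ u≡u′ → l≢l′ (cong (partℕ t) u≡u′)) , Pu , Pu′

module OnlyTwoPVertices {k} (t : CircleTree k) {p q} (only : ∀ r → IsPVertex (tree t) r → r ≡ p ⊎ r ≡ q) where

  no-three-leaves : ∀ {l₁ l₂ l₃} → Leaf t l₁ → Leaf t l₂ → Leaf t l₃ → l₁ ≢ l₂ → l₁ ≢ l₃ → l₂ ≢ l₃ → ⊥
  no-three-leaves leaf₁ leaf₂ leaf₃ l₁≢l₂ l₁≢l₃ l₂≢l₃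
    with Leaf⇒PVertex t leaf₁ | Leaf⇒PVertex t leaf₂ | Leaf⇒PVertex t leaf₃
  ... | u₁ , refl , P₁ | u₂ , refl , P₂ | u₃ , refl , P₃
    with pigeonhole-2 (only u₁ P₁) (only u₂ P₂) (only u₃ P₃)
  ... | inj₁ u₁≡u₂ = l₁≢l₂ (cong (partℕ t) u₁≡u₂)
  ... | inj₂ (inj₁ u₁≡u₃) = l₁≢l₃ (cong (partℕ t) u₁≡u₃)
  ... | inj₂ (inj₂ u₂≡u₃) = l₂≢l₃ (cong (partℕ t) u₂≡u₃)

  qdegree-≤2 : ∀ c → qdegree t c ≤ 2
  qdegree-≤2 c with distinct-leaves t c
  ... | [] , _ , len , _ = subst (_≤ 2) len z≤n
  ... | _ ∷ [] , _ , len , _ = subst (_≤ 2) len (s≤s z≤n)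
  ... | _ ∷ _ ∷ [] , _ , len , _ = subst (_≤ 2) len (s≤s (s≤s z≤n))
  ... | _ ∷ _ ∷ _ ∷ _ , (l₁≢l₂ ∷ l₁≢l₃ ∷ _) ∷ (l₂≢l₃ ∷ _) ∷ _ , _ , (leaf₁ , _) ∷ (leaf₂ , _) ∷ (leaf₃ , _) ∷ _ =
    ⊥-elim (no-three-leaves leaf₁ leaf₂ leaf₃ l₁≢l₂ l₁≢l₃ l₂≢l₃)

  quotient-isLineSegment : ∀ c → Leaf t (toℕ c) → IsLineSegment (quotient t)
  quotient-isLineSegment c leaf = quotient-simple t , quotient-connected t ,
    (λ c′ → _ , qdegree-≤2 (toℕ c′) , quotient-degree t c′) , c , Leaf⇒quotient-degree<2 t c leaf

  PVertices-in-leaves : ∀ {l l′} → Leaf t l → Leaf t l′ → l ≢ l′ →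
                        Leaf t (partℕ t p) × Leaf t (partℕ t q) × partℕ t p ≢ partℕ t q
  PVertices-in-leaves leaf leaf′ l≢l′ with Leaf⇒PVertex t leaf | Leaf⇒PVertex t leaf′
  ... | u , refl , Pu | u′ , refl , Pu′ with only u Pu | only u′ Pu′
  ... | inj₁ refl | inj₁ refl = ⊥-elim (l≢l′ refl)
  ... | inj₂ refl | inj₂ refl = ⊥-elim (l≢l′ refl)
  ... | inj₁ refl | inj₂ refl = leaf , leaf′ , l≢l′
  ... | inj₂ refl | inj₁ refl = leaf′ , leaf , λ l′≡l → l≢l′ (sym l′≡l)

  endpoints : ∀ {l l′} → Leaf t l → Leaf t l′ → l ≢ l′ →
              part t p ≢ part t q × (∃[ d ] (d < 2 × Degree (quotient t) (part t p) d))
                                  × (∃[ d ] (d < 2 × Degree (quotient t) (part t q) d))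
  endpoints leaf leaf′ l≢l′ =
    let leaf-p , leaf-q , p≢q = PVertices-in-leaves leaf leaf′ l≢l′
    in (λ eq → p≢q (cong toℕ eq)) ,
       Leaf⇒quotient-degree<2 t (part t p) leaf-p , Leaf⇒quotient-degree<2 t (part t q) leaf-q

last-circle-leaf : ∀ {k} (t : CircleTree (suc k)) → 1 ≤ k → Leaf t k
last-circle-leaf (base _ _) ()
last-circle-leaf (step t C ic x dx y) _ = Step.qdegree-new t C ic x dx y

lemma4p20 : {k : ℕ} (t : CircleTree (suc k)) → 1 ≤ k →
    ((∃[ p ] ∃[ q ] (p ≢ q × IsPVertex (tree t) p × IsPVertex (tree t) q))
     × (∃[ i ] (toℕ i < k ×
         (∀ j → (j ≡ i ⊎ j ≡ fromℕ k) →
            ∃[ u ] (part t u ≡ j × Degree (tree t) u 3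
                    × (∀ w → part t w ≡ j → Degree (tree t) w 3 → w ≡ u))))))
    × ((∃[ p ] ∃[ q ] (p ≢ q × IsPVertex (tree t) p × IsPVertex (tree t) q
          × (∀ r → IsPVertex (tree t) r → r ≡ p ⊎ r ≡ q))) →
       IsLineSegment (quotient t)
       × (∀ p q → p ≢ q → IsPVertex (tree t) p → IsPVertex (tree t) q →
          (∀ r → IsPVertex (tree t) r → r ≡ p ⊎ r ≡ q) →
          part t p ≢ part t q
          × (∃[ d ] (d < 2 × Degree (quotient t) (part t p) d))
          × (∃[ d ] (d < 2 × Degree (quotient t) (part t q) d))))
lemma4p20 {k} t 1≤k with another-leaf t (last-circle-leaf t 1≤k)
... | l , leaf-l , l≢k =
  (distinct-PVertices t leaf-k leaf-l (≢-sym l≢k) , i , subst (_< k) (sym toℕ-i) l<k , unique-degree-3-at) ,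
  λ (_ , _ , _ , _ , _ , only) → OnlyTwoPVertices.quotient-isLineSegment t only (fromℕ k) leaf-fromℕ ,
    λ _ _ _ _ _ only′ → OnlyTwoPVertices.endpoints t only′ leaf-k leaf-l (≢-sym l≢k)
  where
  leaf-k : Leaf t k
  leaf-k = last-circle-leaf t 1≤k
  leaf-fromℕ : Leaf t (toℕ (fromℕ k))
  leaf-fromℕ = subst (Leaf t) (sym (toℕ-fromℕ k)) leaf-k
  l<k : l < k
  l<k = ≤∧≢⇒< (≤-pred (Leaf⇒< t leaf-l)) l≢k
  i : Fin (suc k)
  i = fromℕ< (m<n⇒m<1+n l<k)
  toℕ-i : toℕ i ≡ l
  toℕ-i = toℕ-fromℕ< (m<n⇒m<1+n l<k)
  unique-degree-3-at : ∀ j → j ≡ i ⊎ j ≡ fromℕ k → UniqueDegree3In t j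
  unique-degree-3-at j (inj₁ refl) = Leaf⇒UniqueDegree3In t j (subst (Leaf t) (sym toℕ-i) leaf-l)
  unique-degree-3-at j (inj₂ refl) = Leaf⇒UniqueDegree3In t j leaf-fromℕ
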